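{- Let $G=(V,E)$ be a finite simple undirected connected graph with $n=|V|\ge 2$. Then $$b(G)=\frac n2\min_S\rho(S),$$ where $\rho(S)=\frac{|\delta(S)|}{|S|(n-|S|)}$ and the minimum is taken over all nonempty subsets $S\subsetneq V$ such that both $S$ and $V\setminus S$ induce connected subgraphs of $G$.
   Context: $b(G)=\min\{\sum_{uv\in E}|x_u-x_v|:\ x\in\mathbb{R}^V,\ \sum_v x_v=0,\ \sum_v|x_v|=1\}$. For $S\subseteq V$, $\delta(S)$ is the set of edges with exactly one endpoint in $S$.
   Formalization: The vectors x in the definition of $b(G)$ range only over ℚ^V rather than ℝ^V. -}

module Defs where

open import Data.Nat as ℕ using (ℕ; zero; suc; _∸_; _<_)
open import Data.Bool using (Bool; true; false; _∧_; _xor_; if_then_else_)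
open import Data.Fin using (Fin; toℕ)
open import Data.Fin.Subset using (Subset; _∈_; ∁; ∣_∣; Nonempty)
open import Data.Vec using (lookup)
open import Data.Integer using (+_)
open import Data.Rational using (ℚ; 0ℚ; _+_; _-_; _*_; _/_; _≤_)
  renaming (∣_∣ to absℚ)
open import Data.Product using (_×_; Σ; ∃)
open import Relation.Binary.PropositionalEquality using (_≡_)
open import Relation.Nullary using (¬_)

sumℚ : {n : ℕ} → (Fin n → ℚ) → ℚ
sumℚ {zero}  f = 0ℚ
sumℚ {suc n} f = f Data.Fin.zero + sumℚ (λ i → f (Data.Fin.suc i))

Adj : ℕ → Set
Adj n = Fin n → Fin n → Bool

IsSimple : {n : ℕ} → Adj n → Set
IsSimple {n} A = (∀ u v → A u v ≡ A v u) × (∀ u → A u u ≡ false)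

data ReachIn {n : ℕ} (A : Adj n) (S : Subset n) : Fin n → Fin n → Set where
  here : ∀ {u} → u ∈ S → ReachIn A S u u
  step : ∀ {u w v} → u ∈ S → A u w ≡ true → ReachIn A S w v → ReachIn A S u v

InducedConnected : {n : ℕ} → Adj n → Subset n → Set
InducedConnected A S = ∀ u v → u ∈ S → v ∈ S → ReachIn A S u v

Connected : {n : ℕ} → Adj n → Set
Connected {n} A = ∀ (u v : Fin n) → ReachIn A (Data.Fin.Subset.⊤) u v

-- Sum over edges uv ∈ E (each unordered edge counted once: u < v).
edgeSum : {n : ℕ} → Adj n → (Fin n → Fin n → ℚ) → ℚ
edgeSum A f = sumℚ (λ u → sumℚ (λ v →
  if A u v ∧ (toℕ u ℕ.<ᵇ toℕ v) then f u v else 0ℚ))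

cutSize : {n : ℕ} → Adj n → Subset n → ℚ
cutSize A S = edgeSum A (λ u v →
  if lookup S u xor lookup S v then + 1 / 1 else 0ℚ)

-- a / d with the convention a/0 = 0 (only used when d ≠ 0).
divℕ : ℚ → ℕ → ℚ
divℕ a zero    = 0ℚ
divℕ a (suc d) = a * (+ 1 / suc d)

ρ : {n : ℕ} → Adj n → Subset n → ℚ
ρ {n} A S = divℕ (cutSize A S) (∣ S ∣ ℕ.* (n ∸ ∣ S ∣))

Admissible : {n : ℕ} → Adj n → Subset n → Set
Admissible A S = Nonempty S × Nonempty (∁ S)
               × InducedConnected A S × InducedConnected A (∁ S)

Feasible : {n : ℕ} → (Fin n → ℚ) → Set
Feasible x = sumℚ x ≡ 0ℚ × sumℚ (λ v → absℚ (x v)) ≡ + 1 / 1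

objective : {n : ℕ} → Adj n → (Fin n → ℚ) → ℚ
objective A x = edgeSum A (λ u v → absℚ (x u - x v))

IsB : {n : ℕ} → Adj n → ℚ → Set
IsB A β = (∀ x → Feasible x → β ≤ objective A x)
        × Σ _ (λ x → Feasible x × objective A x ≡ β)

{-# OPTIONS --safe #-}
module Submission where

-- Let r be the least value of ρ over all nonempty proper subsets S, admissible or not.
-- For the weights w = edge − r/2 on ordered pairs, the w-variation Σ_{u,v} w(u,v) |x_u − x_v|
-- of a cut indicator 1_S is |δ(S)| − r |S| (n − |S|) ≥ 0. Cutting a vector x at its values
-- (co-area) writes its w-variation as a nonnegative combination of those of cut indicators,
-- so it is nonnegative too; with Σ_{u,v} |x_u − x_v| ≥ n Σ_v |x_v| for Σ x = 0 this gives
-- b(G) ≥ (n/2) r. A minimiser S₀ attains the bound with x equal to 1/(2|S₀|) on S₀ and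
-- −1/(2|V∖S₀|) off it. Finally S₀ is admissible: were G[S₀] (or G[V∖S₀]) split into a
-- component R and a nonempty rest T with no edges between them, then
-- |δ(S₀)| = |δ(R)| + |δ(T)| ≥ r |R| (n − |R|) + r |T| (n − |T|) = |δ(S₀)| + 2r |R| |T|,
-- impossible as r > 0 (G is connected).

open import Defs
open import Data.Nat using (ℕ; _≤_)
open import Data.Integer using (+_)
open import Data.Rational using (_*_; _/_) renaming (_≤_ to _≤ℚ_)
open import Data.Fin.Subset using (Subset)
open import Data.Product using (Σ; _×_)

open import Algebra.Bundles using (CommutativeRing)
open import Data.Bool as Bool using (Bool; true; false; not; if_then_else_; _∧_; _∨_; _xor_)
import Data.Bool.Properties as BoolP
open import Data.Empty using (⊥-elim)
open import Data.Fin as Fin using (Fin; toℕ)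
import Data.Fin.Properties as FinP
import Data.Fin.Subset as Subset
open Subset using (∁; Nonempty; _∈_; _∪_; ⁅_⁆; _⊃_)
open import Data.Fin.Subset.Induction using (⊃-wellFounded)
import Data.Fin.Subset.Properties as SubsetP
import Data.Integer as ℤ
open import Data.Integer.Tactic.RingSolver using (solve-∀)
open import Data.List using (List; []; _∷_; [_]; tabulate; map; _++_; filter)
open import Data.List.Membership.Propositional using () renaming (_∈_ to _∈ₗ_)
open import Data.List.Membership.Propositional.Properties using (∈-tabulate⁺; ∈-map⁺; ∈-++⁺ˡ; ∈-++⁺ʳ; ∈-filter⁺)
import Data.List.Relation.Unary.All as All
open import Data.List.Relation.Unary.All.Properties using (all-filter)
open import Data.List.Relation.Unary.Any using (here; there)
open import Data.List.Relation.Unary.Any.Properties using (¬Any[])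
open import Data.List.Relation.Unary.Linked using ([]; [-]; _∷_)
open import Data.List.Relation.Unary.Linked.Properties using (Linked⇒All)
open import Data.List.Relation.Binary.Permutation.Propositional using (↭-sym)
open import Data.List.Relation.Binary.Permutation.Propositional.Properties using (∈-resp-↭)
open import Data.Nat as ℕ using (zero; suc)
import Data.Nat.Properties as ℕP
open import Data.Product using (_,_; proj₁; proj₂; ∃)
open import Data.Rational as ℚ using (ℚ; 0ℚ; 1ℚ; ½; _+_; _-_; -_; ∣_∣; _⊔_; _⊓_; _<_; toℚᵘ)
import Data.Rational.Properties as ℚP
open import Data.Rational.Solver using (module +-*-Solver)
import Data.Rational.Unnormalised as ℚᵘ
import Data.Rational.Unnormalised.Properties as ℚᵘP
open import Data.Sum using (_⊎_; inj₁; inj₂; map₂)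
open import Data.Vec as Vec using ([]; _∷_; lookup)
import Data.Vec.Properties as VecP
open import Function using (_∘_)
open import Function.Bundles using (Equivalence)
open import Induction.WellFounded using (Acc; acc)
open import Level using (0ℓ)
open import Relation.Binary.Bundles using (DecTotalOrder)
open import Relation.Binary.Definitions using (tri<; tri≈; tri>)
open import Relation.Binary.PropositionalEquality hiding ([_])
open import Relation.Nullary using (Dec; yes; no; does; ¬_; ¬?)
open import Relation.Nullary.Decidable using (_×-dec_)
open import Relation.Unary using (Pred; Decidable)

open import Algebra.Properties.Semiring.Sum (CommutativeRing.semiring ℚP.+-*-commutativeRing)
  using (sum; sum-syntax; sum-cong-≗; ∑-distrib-+; *-distribˡ-sum; *-distribʳ-sum; sum-replicate; sum-replicate-zero)
open import Algebra.Properties.Semiring.Mult (CommutativeRing.semiring ℚP.+-*-commutativeRing)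
  using (×1-homo-*; ×-assoc-*) renaming (_×_ to _×ℚ_)
open import Data.List.Extrema (DecTotalOrder.totalOrder ℚP.≤-decTotalOrder) using (argmin; argmin-all; f[argmin]≤f[xs])
open import Data.List.Relation.Unary.Sorted.TotalOrder (DecTotalOrder.totalOrder ℚP.≤-decTotalOrder) using (Sorted)
open import Data.List.Sort ℚP.≤-decTotalOrder using (sort-↭; sort-↗)

*-nonneg : ∀ {p q} → 0ℚ ≤ℚ p → 0ℚ ≤ℚ q → 0ℚ ≤ℚ p * q
*-nonneg {p} {q} p≥0 q≥0 = ℚP.nonNegative⁻¹ (p * q) {{ℚP.nonNeg*nonNeg⇒nonNeg p {{ℚ.nonNegative p≥0}} q {{ℚ.nonNegative q≥0}}}}

*-pos : ∀ {p q} → 0ℚ < p → 0ℚ < q → 0ℚ < p * q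
*-pos {p} {q} p>0 q>0 = ℚP.positive⁻¹ (p * q) {{ℚP.pos*pos⇒pos p {{ℚ.positive p>0}} q {{ℚ.positive q>0}}}}

*-monoˡ-≤-nonneg : ∀ {c p q} → 0ℚ ≤ℚ c → p ≤ℚ q → c * p ≤ℚ c * q
*-monoˡ-≤-nonneg {c} c≥0 = ℚP.*-monoˡ-≤-nonNeg c {{ℚ.nonNegative c≥0}}

*-monoʳ-≤-nonneg : ∀ {c p q} → 0ℚ ≤ℚ c → p ≤ℚ q → p * c ≤ℚ q * c
*-monoʳ-≤-nonneg {c} c≥0 = ℚP.*-monoʳ-≤-nonNeg c {{ℚ.nonNegative c≥0}}

1≤⇒0< : ∀ {p} → 1ℚ ≤ℚ p → 0ℚ < p
1≤⇒0< = ℚP.<-≤-trans (ℚP.positive⁻¹ 1ℚ)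

p≤q⇒0≤q-p : ∀ {p q} → p ≤ℚ q → 0ℚ ≤ℚ q - p
p≤q⇒0≤q-p {p} p≤q = ℚP.≤-trans (ℚP.≤-reflexive (sym (ℚP.+-inverseʳ p))) (ℚP.+-monoˡ-≤ (- p) p≤q)

0≤q-p⇒p≤q : ∀ {p q} → 0ℚ ≤ℚ q - p → p ≤ℚ q
0≤q-p⇒p≤q {p} {q} 0≤q-p = begin
  p              ≡⟨ ℚP.+-identityˡ p ⟨
  0ℚ + p         ≤⟨ ℚP.+-monoˡ-≤ p 0≤q-p ⟩
  (q - p) + p    ≡⟨ cancel q p ⟩
  q              ∎
  where
  open ℚP.≤-Reasoning
  open +-*-Solver
  cancel : ∀ q p → (q - p) + p ≡ q
  cancel = solve 2 (λ q p → (q :- p) :+ p := q) refl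

∣p-q∣≡∣q-p∣ : ∀ p q → ∣ p - q ∣ ≡ ∣ q - p ∣
∣p-q∣≡∣q-p∣ p q = trans (sym (ℚP.∣-p∣≡∣p∣ (p - q))) (cong ∣_∣ (neg-sub p q))
  where
  open +-*-Solver
  neg-sub : ∀ p q → - (p - q) ≡ q - p
  neg-sub = solve 2 (λ p q → :- (p :- q) := q :- p) refl

p≤q⇒∣p-q∣≡q-p : ∀ {p q} → p ≤ℚ q → ∣ p - q ∣ ≡ q - p
p≤q⇒∣p-q∣≡q-p {p} {q} p≤q = trans (∣p-q∣≡∣q-p∣ p q) (ℚP.0≤p⇒∣p∣≡p (p≤q⇒0≤q-p p≤q))

p⊔q+p⊓q≡p+q : ∀ p q → (p ⊔ q) + (p ⊓ q) ≡ p + q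
p⊔q+p⊓q≡p+q p q with ℚP.≤-total p q
... | inj₁ p≤q = trans (cong₂ _+_ (ℚP.p≤q⇒p⊔q≡q p≤q) (ℚP.p≤q⇒p⊓q≡p p≤q)) (ℚP.+-comm q p)
... | inj₂ q≤p = cong₂ _+_ (ℚP.p≥q⇒p⊔q≡p q≤p) (ℚP.p≥q⇒p⊓q≡q q≤p)

∣p-q∣-clamp-≤ : ∀ m {p q} → p ≤ℚ q → ∣ p - q ∣ ≡ ∣ (p ⊔ m) - (q ⊔ m) ∣ + ∣ (p ⊓ m) - (q ⊓ m) ∣
∣p-q∣-clamp-≤ m {p} {q} p≤q = begin
  ∣ p - q ∣                                             ≡⟨ p≤q⇒∣p-q∣≡q-p p≤q ⟩
  q - p                                                 ≡⟨ shift p q m ⟩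
  (q + m) - (p + m)                                     ≡⟨ cong₂ _-_ (p⊔q+p⊓q≡p+q q m) (p⊔q+p⊓q≡p+q p m) ⟨
  ((q ⊔ m) + (q ⊓ m)) - ((p ⊔ m) + (p ⊓ m))             ≡⟨ interchange (q ⊔ m) (q ⊓ m) (p ⊔ m) (p ⊓ m) ⟩
  ((q ⊔ m) - (p ⊔ m)) + ((q ⊓ m) - (p ⊓ m))             ≡⟨ cong₂ _+_ (p≤q⇒∣p-q∣≡q-p {p ⊔ m} {q ⊔ m} (ℚP.⊔-monoˡ-≤ m p≤q))
                                                                     (p≤q⇒∣p-q∣≡q-p {p ⊓ m} {q ⊓ m} (ℚP.⊓-monoˡ-≤ m p≤q)) ⟨
  ∣ (p ⊔ m) - (q ⊔ m) ∣ + ∣ (p ⊓ m) - (q ⊓ m) ∣         ∎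
  where
  open ≡-Reasoning
  open +-*-Solver
  shift : ∀ p q m → q - p ≡ (q + m) - (p + m)
  shift = solve 3 (λ p q m → q :- p := (q :+ m) :- (p :+ m)) refl
  interchange : ∀ a b c d → (a + b) - (c + d) ≡ (a - c) + (b - d)
  interchange = solve 4 (λ a b c d → (a :+ b) :- (c :+ d) := (a :- c) :+ (b :- d)) refl

∣p-q∣-clamp : ∀ m p q → ∣ p - q ∣ ≡ ∣ (p ⊔ m) - (q ⊔ m) ∣ + ∣ (p ⊓ m) - (q ⊓ m) ∣
∣p-q∣-clamp m p q with ℚP.≤-total p q
... | inj₁ p≤q = ∣p-q∣-clamp-≤ m p≤q
... | inj₂ q≤p = begin
  ∣ p - q ∣                                        ≡⟨ ∣p-q∣≡∣q-p∣ p q ⟩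
  ∣ q - p ∣                                        ≡⟨ ∣p-q∣-clamp-≤ m q≤p ⟩
  ∣ (q ⊔ m) - (p ⊔ m) ∣ + ∣ (q ⊓ m) - (p ⊓ m) ∣    ≡⟨ cong₂ _+_ (∣p-q∣≡∣q-p∣ (q ⊔ m) (p ⊔ m)) (∣p-q∣≡∣q-p∣ (q ⊓ m) (p ⊓ m)) ⟩
  ∣ (p ⊔ m) - (q ⊔ m) ∣ + ∣ (p ⊓ m) - (q ⊓ m) ∣    ∎
  where open ≡-Reasoning

fromℕ : ℕ → ℚ
fromℕ k = k ×ℚ 1ℚ

fromℕ-nonneg : ∀ k → 0ℚ ≤ℚ fromℕ k
fromℕ-nonneg zero    = ℚP.≤-refl
fromℕ-nonneg (suc k) = ℚP.+-mono-≤ (ℚP.<⇒≤ (ℚP.positive⁻¹ 1ℚ)) (fromℕ-nonneg k)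

fromℕ≡/1 : ∀ k → fromℕ k ≡ + k / 1
fromℕ≡/1 zero    = refl
fromℕ≡/1 (suc k) = trans (cong (λ q → 1ℚ + q) (fromℕ≡/1 k)) (ℚP.toℚᵘ-injective (begin
  toℚᵘ (1ℚ + + k / 1)                      ≈⟨ ℚP.toℚᵘ-homo-+ 1ℚ (+ k / 1) ⟩
  toℚᵘ 1ℚ ℚᵘ.+ toℚᵘ (+ k / 1)             ≈⟨ ℚᵘP.+-congʳ (toℚᵘ 1ℚ) (ℚP.toℚᵘ-fromℚᵘ (ℚᵘ.mkℚᵘ (+ k) 0)) ⟩
  ℚᵘ.mkℚᵘ (+ 1) 0 ℚᵘ.+ ℚᵘ.mkℚᵘ (+ k) 0    ≈⟨ ℚᵘ.*≡* (lemma (+ k)) ⟩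
  ℚᵘ.mkℚᵘ (+ suc k) 0                     ≈⟨ ℚP.toℚᵘ-fromℚᵘ (ℚᵘ.mkℚᵘ (+ suc k) 0) ⟨
  toℚᵘ (+ suc k / 1)                      ∎))
  where
  open ℚᵘP.≃-Reasoning
  lemma : ∀ i → (+ 1 ℤ.* + 1 ℤ.+ i ℤ.* + 1) ℤ.* + 1 ≡ (+ 1 ℤ.+ i) ℤ.* (+ 1 ℤ.* + 1)
  lemma = solve-∀

1/suc*fromℕ-suc : ∀ k → (+ 1 / suc k) * fromℕ (suc k) ≡ 1ℚ
1/suc*fromℕ-suc k = trans (cong (λ q → (+ 1 / suc k) * q) (fromℕ≡/1 (suc k))) (ℚP.toℚᵘ-injective (begin
  toℚᵘ ((+ 1 / suc k) * (+ suc k / 1))           ≈⟨ ℚP.toℚᵘ-homo-* (+ 1 / suc k) (+ suc k / 1) ⟩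
  toℚᵘ (+ 1 / suc k) ℚᵘ.* toℚᵘ (+ suc k / 1)     ≈⟨ ℚᵘP.*-cong (ℚP.toℚᵘ-fromℚᵘ (ℚᵘ.mkℚᵘ (+ 1) k)) (ℚP.toℚᵘ-fromℚᵘ (ℚᵘ.mkℚᵘ (+ suc k) 0)) ⟩
  ℚᵘ.mkℚᵘ (+ 1) k ℚᵘ.* ℚᵘ.mkℚᵘ (+ suc k) 0        ≈⟨ ℚᵘP.*-inverseˡ (ℚᵘ.mkℚᵘ (+ suc k) 0) ⟩
  toℚᵘ 1ℚ                                         ∎))
  where open ℚᵘP.≃-Reasoning

divℕ-cancel : ∀ c k → 0ℚ < fromℕ k → divℕ c k * fromℕ k ≡ c
divℕ-cancel c zero    0<0 = ⊥-elim (ℚP.<-irrefl refl 0<0)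
divℕ-cancel c (suc k) _ = begin
  c * (+ 1 / suc k) * fromℕ (suc k)    ≡⟨ ℚP.*-assoc c _ _ ⟩
  c * ((+ 1 / suc k) * fromℕ (suc k))  ≡⟨ cong (c *_) (1/suc*fromℕ-suc k) ⟩
  c * 1ℚ                               ≡⟨ ℚP.*-identityʳ c ⟩
  c                                    ∎
  where open ≡-Reasoning

divℕ-nonneg : ∀ {c} k → 0ℚ ≤ℚ c → 0ℚ ≤ℚ divℕ c k
divℕ-nonneg zero    _   = ℚP.≤-refl
divℕ-nonneg (suc k) c≥0 = *-nonneg c≥0 (ℚP.nonNegative⁻¹ (+ 1 / suc k) {{ℚP.normalize-nonNeg 1 (suc k)}})

/2≡fromℕ*½ : ∀ n → + n / 2 ≡ fromℕ n * ½
/2≡fromℕ*½ n = sym (trans (cong (_* ½) (fromℕ≡/1 n)) (ℚP.toℚᵘ-injective (begin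
  toℚᵘ ((+ n / 1) * ½)                    ≈⟨ ℚP.toℚᵘ-homo-* (+ n / 1) ½ ⟩
  toℚᵘ (+ n / 1) ℚᵘ.* toℚᵘ ½              ≈⟨ ℚᵘP.*-congʳ (ℚP.toℚᵘ-fromℚᵘ (ℚᵘ.mkℚᵘ (+ n) 0)) ⟩
  ℚᵘ.mkℚᵘ (+ n) 0 ℚᵘ.* ℚᵘ.mkℚᵘ (+ 1) 1     ≈⟨ ℚᵘ.*≡* (lemma (+ n)) ⟩
  ℚᵘ.mkℚᵘ (+ n) 1                          ≈⟨ ℚP.toℚᵘ-fromℚᵘ (ℚᵘ.mkℚᵘ (+ n) 1) ⟨
  toℚᵘ (+ n / 2)                           ∎)))
  where
  open ℚᵘP.≃-Reasoning
  lemma : ∀ i → (i ℤ.* + 1) ℤ.* + 2 ≡ i ℤ.* (+ 1 ℤ.* + 2)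
  lemma = solve-∀

sumℚ≡sum : ∀ {n} (f : Fin n → ℚ) → sumℚ f ≡ sum f
sumℚ≡sum {zero}  f = refl
sumℚ≡sum {suc n} f = cong (_+_ (f Fin.zero)) (sumℚ≡sum (f ∘ Fin.suc))

sum-mono-≤ : ∀ {n} {f g : Fin n → ℚ} → (∀ i → f i ≤ℚ g i) → sum f ≤ℚ sum g
sum-mono-≤ {zero}  f≤g = ℚP.≤-refl
sum-mono-≤ {suc n} f≤g = ℚP.+-mono-≤ (f≤g Fin.zero) (sum-mono-≤ (f≤g ∘ Fin.suc))

sum-nonneg : ∀ {n} {f : Fin n → ℚ} → (∀ i → 0ℚ ≤ℚ f i) → 0ℚ ≤ℚ sum f
sum-nonneg {zero}  f≥0 = ℚP.≤-refl
sum-nonneg {suc n} f≥0 = ℚP.+-mono-≤ (f≥0 Fin.zero) (sum-nonneg (f≥0 ∘ Fin.suc))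

term≤sum : ∀ {n} {f : Fin n → ℚ} → (∀ i → 0ℚ ≤ℚ f i) → ∀ j → f j ≤ℚ sum f
term≤sum {suc n} {f} f≥0 Fin.zero    = ℚP.≤-trans (ℚP.≤-reflexive (sym (ℚP.+-identityʳ (f Fin.zero))))
  (ℚP.+-monoʳ-≤ (f Fin.zero) (sum-nonneg (f≥0 ∘ Fin.suc)))
term≤sum {suc n} {f} f≥0 (Fin.suc j) = ℚP.≤-trans (term≤sum (f≥0 ∘ Fin.suc) j)
  (ℚP.≤-trans (ℚP.≤-reflexive (sym (ℚP.+-identityˡ _))) (ℚP.+-monoˡ-≤ _ (f≥0 Fin.zero)))

∣sum∣≤sum∣∣ : ∀ {n} (f : Fin n → ℚ) → ∣ sum f ∣ ≤ℚ sum (∣_∣ ∘ f)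
∣sum∣≤sum∣∣ {zero}  f = ℚP.≤-refl
∣sum∣≤sum∣∣ {suc n} f = ℚP.≤-trans (ℚP.∣p+q∣≤∣p∣+∣q∣ (f Fin.zero) _)
  (ℚP.+-monoʳ-≤ ∣ f Fin.zero ∣ (∣sum∣≤sum∣∣ (f ∘ Fin.suc)))

∑-const : ∀ n c → ∑[ i < n ] c ≡ fromℕ n * c
∑-const n c = begin
  ∑[ i < n ] c       ≡⟨ sum-replicate n ⟩
  n ×ℚ c             ≡⟨ cong (n ×ℚ_) (ℚP.*-identityˡ c) ⟨
  n ×ℚ (1ℚ * c)      ≡⟨ ×-assoc-* n 1ℚ c ⟨
  fromℕ n * c        ∎
  where open ≡-Reasoning

∑∑-cong : ∀ {n} {f g : Fin n → Fin n → ℚ} → (∀ u v → f u v ≡ g u v) →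
          ∑[ u < n ] ∑[ v < n ] f u v ≡ ∑[ u < n ] ∑[ v < n ] g u v
∑∑-cong {n} f≡g = sum-cong-≗ {n} (λ u → sum-cong-≗ {n} (f≡g u))

∑∑-distrib-+ : ∀ {n} (f g : Fin n → Fin n → ℚ) →
               ∑[ u < n ] ∑[ v < n ] (f u v + g u v) ≡ ∑[ u < n ] ∑[ v < n ] f u v + ∑[ u < n ] ∑[ v < n ] g u v
∑∑-distrib-+ {n} f g = trans (sum-cong-≗ {n} (λ u → ∑-distrib-+ (f u) (g u)))
                             (∑-distrib-+ (λ u → ∑[ v < n ] f u v) (λ u → ∑[ v < n ] g u v))

*-distribˡ-∑∑ : ∀ {n} c (f : Fin n → Fin n → ℚ) → c * ∑[ u < n ] ∑[ v < n ] f u v ≡ ∑[ u < n ] ∑[ v < n ] (c * f u v)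
*-distribˡ-∑∑ {n} c f = trans (*-distribˡ-sum c (λ u → ∑[ v < n ] f u v)) (sum-cong-≗ {n} (λ u → *-distribˡ-sum c (f u)))

∑∑-zero : ∀ n → ∑[ u < n ] ∑[ v < n ] 0ℚ ≡ 0ℚ
∑∑-zero n = begin
  ∑[ u < n ] ∑[ v < n ] 0ℚ   ≡⟨ sum-cong-≗ {n} (λ _ → sum-replicate-zero n) ⟩
  ∑[ u < n ] 0ℚ              ≡⟨ sum-replicate-zero n ⟩
  0ℚ                         ∎
  where open ≡-Reasoning

term≤∑∑ : ∀ {n} {f : Fin n → Fin n → ℚ} → (∀ u v → 0ℚ ≤ℚ f u v) → ∀ p q → f p q ≤ℚ ∑[ u < n ] ∑[ v < n ] f u v
term≤∑∑ f≥0 p q = ℚP.≤-trans (term≤sum (f≥0 p) q) (term≤sum (λ u → sum-nonneg (f≥0 u)) p)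

-- Weighted variation

𝟙 : Bool → ℚ
𝟙 b = if b then 1ℚ else 0ℚ

𝟙-nonneg : ∀ b → 0ℚ ≤ℚ 𝟙 b
𝟙-nonneg true  = ℚP.<⇒≤ (ℚP.positive⁻¹ 1ℚ)
𝟙-nonneg false = ℚP.≤-refl

∣𝟙-𝟙∣≡𝟙-xor : ∀ a b → ∣ 𝟙 a - 𝟙 b ∣ ≡ 𝟙 (a xor b)
∣𝟙-𝟙∣≡𝟙-xor true  true  = refl
∣𝟙-𝟙∣≡𝟙-xor true  false = refl
∣𝟙-𝟙∣≡𝟙-xor false true  = refl
∣𝟙-𝟙∣≡𝟙-xor false false = refl

⊓-threshold : ∀ {a b y} → a ≤ℚ b → y ≡ a ⊎ b ≤ℚ y → y ⊓ b ≡ a + (b - a) * 𝟙 (does (b ℚP.≤? y))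
⊓-threshold {a} {b} {y} a≤b y≡a⊎b≤y = by-cases (b ℚP.≤? y) y≡a⊎b≤y
  where
  open +-*-Solver
  by-cases : (b≤?y : Dec (b ≤ℚ y)) → y ≡ a ⊎ b ≤ℚ y → y ⊓ b ≡ a + (b - a) * 𝟙 (does b≤?y)
  by-cases (yes b≤y) _           = trans (ℚP.p≥q⇒p⊓q≡q b≤y) (sym (solve 2 (λ a b → a :+ (b :- a) :* con 1ℚ := b) refl a b))
  by-cases (no  _)   (inj₁ refl) = trans (ℚP.p≤q⇒p⊓q≡p a≤b) (sym (solve 2 (λ a b → a :+ (b :- a) :* con 0ℚ := a) refl a b))
  by-cases (no  b≰y) (inj₂ b≤y)  = ⊥-elim (b≰y b≤y)

variation : ∀ {n} → (Fin n → Fin n → ℚ) → (Fin n → ℚ) → ℚ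
variation {n} w x = ∑[ u < n ] ∑[ v < n ] (w u v * ∣ x u - x v ∣)

module _ {n} (w : Fin n → Fin n → ℚ) where

  variation-cong : ∀ {x y : Fin n → ℚ} → (∀ v → x v ≡ y v) → variation w x ≡ variation w y
  variation-cong x≗y = ∑∑-cong (λ u v → cong₂ (λ p q → w u v * ∣ p - q ∣) (x≗y u) (x≗y v))

  variation-const : ∀ {x : Fin n → ℚ} a → (∀ v → x v ≡ a) → variation w x ≡ 0ℚ
  variation-const {x} a x≡a = begin
    variation w x                 ≡⟨ variation-cong x≡a ⟩
    variation w (λ _ → a)         ≡⟨ ∑∑-cong (λ u v → trans (cong (λ d → w u v * ∣ d ∣) (ℚP.+-inverseʳ a)) (ℚP.*-zeroʳ (w u v))) ⟩
    ∑[ u < n ] ∑[ v < n ] 0ℚ      ≡⟨ ∑∑-zero n ⟩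
    0ℚ                            ∎
    where open ≡-Reasoning

  variation-clamp : ∀ m (x : Fin n → ℚ) → variation w x ≡ variation w (λ v → x v ⊔ m) + variation w (λ v → x v ⊓ m)
  variation-clamp m x = begin
    variation w x
      ≡⟨ ∑∑-cong (λ u v → trans (cong (w u v *_) (∣p-q∣-clamp m (x u) (x v))) (ℚP.*-distribˡ-+ (w u v) _ _)) ⟩
    ∑[ u < n ] ∑[ v < n ] (w u v * ∣ (x u ⊔ m) - (x v ⊔ m) ∣ + w u v * ∣ (x u ⊓ m) - (x v ⊓ m) ∣)
      ≡⟨ ∑∑-distrib-+ (λ u v → w u v * ∣ (x u ⊔ m) - (x v ⊔ m) ∣) (λ u v → w u v * ∣ (x u ⊓ m) - (x v ⊓ m) ∣) ⟩
    variation w (λ v → x v ⊔ m) + variation w (λ v → x v ⊓ m)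
      ∎
    where open ≡-Reasoning

  variation-affine : ∀ a c (y : Fin n → ℚ) → variation w (λ v → a + c * y v) ≡ ∣ c ∣ * variation w y
  variation-affine a c y = begin
    variation w (λ v → a + c * y v)                         ≡⟨ ∑∑-cong term ⟩
    ∑[ u < n ] ∑[ v < n ] (∣ c ∣ * (w u v * ∣ y u - y v ∣))  ≡⟨ *-distribˡ-∑∑ ∣ c ∣ (λ u v → w u v * ∣ y u - y v ∣) ⟨
    ∣ c ∣ * variation w y                                   ∎
    where
    open ≡-Reasoning
    open +-*-Solver
    translate : ∀ a c p q → (a + c * p) - (a + c * q) ≡ c * (p - q)
    translate = solve 4 (λ a c p q → (a :+ c :* p) :- (a :+ c :* q) := c :* (p :- q)) refl
    swap : ∀ w c d → w * (c * d) ≡ c * (w * d)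
    swap = solve 3 (λ w c d → w :* (c :* d) := c :* (w :* d)) refl
    term : ∀ u v → w u v * ∣ (a + c * y u) - (a + c * y v) ∣ ≡ ∣ c ∣ * (w u v * ∣ y u - y v ∣)
    term u v = trans (cong (λ d → w u v * ∣ d ∣) (translate a c (y u) (y v)))
                     (trans (cong (w u v *_) (ℚP.∣p*q∣≡∣p∣*∣q∣ c _)) (swap (w u v) ∣ c ∣ _))

variation-sub : ∀ {n} (w₁ w₂ : Fin n → Fin n → ℚ) c x →
                variation (λ u v → w₁ u v - c * w₂ u v) x ≡ variation w₁ x - c * variation w₂ x
variation-sub {n} w₁ w₂ c x = begin
  variation (λ u v → w₁ u v - c * w₂ u v) x
    ≡⟨ ∑∑-cong (λ u v → distrib (w₁ u v) (w₂ u v) c ∣ x u - x v ∣) ⟩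
  ∑[ u < n ] ∑[ v < n ] (w₁ u v * ∣ x u - x v ∣ + - c * (w₂ u v * ∣ x u - x v ∣))
    ≡⟨ ∑∑-distrib-+ (λ u v → w₁ u v * ∣ x u - x v ∣) (λ u v → - c * (w₂ u v * ∣ x u - x v ∣)) ⟩
  variation w₁ x + ∑[ u < n ] ∑[ v < n ] (- c * (w₂ u v * ∣ x u - x v ∣))
    ≡⟨ cong (_+_ (variation w₁ x)) (*-distribˡ-∑∑ (- c) (λ u v → w₂ u v * ∣ x u - x v ∣)) ⟨
  variation w₁ x + - c * variation w₂ x
    ≡⟨ cong (_+_ (variation w₁ x)) (ℚP.neg-distribˡ-* c (variation w₂ x)) ⟨
  variation w₁ x - c * variation w₂ x
    ∎
  where
  open ≡-Reasoning
  open +-*-Solver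
  distrib : ∀ a b c d → (a - c * b) * d ≡ a * d + - c * (b * d)
  distrib = solve 4 (λ a b c d → (a :- c :* b) :* d := a :* d :+ (:- c) :* (b :* d)) refl

module _ {n} (w : Fin n → Fin n → ℚ) (cuts-nonneg : ∀ (s : Fin n → Bool) → 0ℚ ≤ℚ variation w (𝟙 ∘ s)) where

  -- Clamping at the second smallest value b leaves x ⊓ b with the two values a, b, an affine
  -- image of the cut indicator of {x ≥ b}, and x ⊔ b with one value fewer than x.
  private
    nonneg-on-sorted : ∀ {vs} → Sorted vs → (x : Fin n → ℚ) → (∀ v → x v ∈ₗ vs) → 0ℚ ≤ℚ variation w x
    nonneg-on-sorted []  x x∈vs = ℚP.≤-reflexive (sym (variation-const w {x} 0ℚ (λ v → ⊥-elim (¬Any[] (x∈vs v)))))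
    nonneg-on-sorted {a ∷ []} [-] x x∈vs = ℚP.≤-reflexive (sym (variation-const w {x} a (λ v → singleton (x∈vs v))))
      where
      singleton : ∀ {y} → y ∈ₗ [ a ] → y ≡ a
      singleton (here y≡a) = y≡a
    nonneg-on-sorted {a ∷ b ∷ vs} (a≤b ∷ sorted) x x∈vs = begin
      0ℚ                                                       ≤⟨ ℚP.+-mono-≤ upper-nonneg lower-nonneg ⟩
      variation w (λ v → x v ⊔ b) + variation w (λ v → x v ⊓ b) ≡⟨ variation-clamp w b x ⟨
      variation w x                                            ∎
      where
      open ℚP.≤-Reasoning
      b≤tail : All.All (b ≤ℚ_) (b ∷ vs)
      b≤tail = Linked⇒All ℚP.≤-trans ℚP.≤-refl sorted
      split : ∀ v → x v ≡ a ⊎ (x v ∈ₗ b ∷ vs × b ≤ℚ x v)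
      split v with x∈vs v
      ... | here x≡a = inj₁ x≡a
      ... | there x∈tail = inj₂ (x∈tail , All.lookup b≤tail x∈tail)
      above : Fin n → Bool
      above v = does (b ℚP.≤? x v)
      lower-nonneg : 0ℚ ≤ℚ variation w (λ v → x v ⊓ b)
      lower-nonneg = begin
        0ℚ                                             ≤⟨ *-nonneg (ℚP.0≤∣p∣ (b - a)) (cuts-nonneg above) ⟩
        ∣ b - a ∣ * variation w (𝟙 ∘ above)            ≡⟨ variation-affine w a (b - a) (𝟙 ∘ above) ⟨
        variation w (λ v → a + (b - a) * 𝟙 (above v))  ≡⟨ variation-cong w (λ v → ⊓-threshold a≤b (map₂ proj₂ (split v))) ⟨
        variation w (λ v → x v ⊓ b)                    ∎
      upper∈tail : ∀ v → x v ⊔ b ∈ₗ b ∷ vs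
      upper∈tail v with split v
      ... | inj₁ x≡a = here (trans (cong (_⊔ b) x≡a) (ℚP.p≤q⇒p⊔q≡q a≤b))
      ... | inj₂ (x∈tail , b≤x) = subst (_∈ₗ b ∷ vs) (sym (ℚP.p≥q⇒p⊔q≡p b≤x)) x∈tail
      upper-nonneg : 0ℚ ≤ℚ variation w (λ v → x v ⊔ b)
      upper-nonneg = nonneg-on-sorted sorted (λ v → x v ⊔ b) upper∈tail

  variation-nonneg : ∀ x → 0ℚ ≤ℚ variation w x
  variation-nonneg x = nonneg-on-sorted (sort-↗ values) x (λ v → ∈-resp-↭ (↭-sym (sort-↭ values)) (∈-tabulate⁺ v))
    where
    values : List ℚ
    values = tabulate x

∑-centred : ∀ {n} (x : Fin n → ℚ) → sum x ≡ 0ℚ → ∀ c → ∑[ v < n ] (c - x v) ≡ fromℕ n * c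
∑-centred {n} x ∑x≡0 c = begin
  ∑[ v < n ] (c - x v)                 ≡⟨ ℚP.+-identityʳ _ ⟨
  ∑[ v < n ] (c - x v) + 0ℚ            ≡⟨ cong (_+_ (∑[ v < n ] (c - x v))) ∑x≡0 ⟨
  ∑[ v < n ] (c - x v) + sum x         ≡⟨ ∑-distrib-+ (λ v → c - x v) x ⟨
  ∑[ v < n ] ((c - x v) + x v)         ≡⟨ sum-cong-≗ {n} (λ v → cancel c (x v)) ⟩
  ∑[ v < n ] c                         ≡⟨ ∑-const n c ⟩
  fromℕ n * c                          ∎
  where
  open ≡-Reasoning
  open +-*-Solver
  cancel : ∀ c y → (c - y) + y ≡ c
  cancel = solve 2 (λ c y → (c :- y) :+ y := c) refl

mean-deviation : ∀ {n} (x : Fin n → ℚ) → sum x ≡ 0ℚ → fromℕ n * sum (∣_∣ ∘ x) ≤ℚ variation (λ _ _ → 1ℚ) x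
mean-deviation {n} x ∑x≡0 = begin
  fromℕ n * sum (∣_∣ ∘ x)                 ≡⟨ *-distribˡ-sum (fromℕ n) (∣_∣ ∘ x) ⟩
  ∑[ u < n ] (fromℕ n * ∣ x u ∣)          ≡⟨ sum-cong-≗ {n} as-centred-sum ⟩
  ∑[ u < n ] ∣ ∑[ v < n ] (x u - x v) ∣   ≤⟨ sum-mono-≤ (λ u → ∣sum∣≤sum∣∣ (λ v → x u - x v)) ⟩
  ∑[ u < n ] ∑[ v < n ] ∣ x u - x v ∣     ≡⟨ ∑∑-cong (λ u v → ℚP.*-identityˡ ∣ x u - x v ∣) ⟨
  variation (λ _ _ → 1ℚ) x                ∎
  where
  open ℚP.≤-Reasoning
  as-centred-sum : ∀ u → fromℕ n * ∣ x u ∣ ≡ ∣ ∑[ v < n ] (x u - x v) ∣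
  as-centred-sum u = begin-equality
    fromℕ n * ∣ x u ∣        ≡⟨ cong (_* ∣ x u ∣) (ℚP.0≤p⇒∣p∣≡p (fromℕ-nonneg n)) ⟨
    ∣ fromℕ n ∣ * ∣ x u ∣    ≡⟨ ℚP.∣p*q∣≡∣p∣*∣q∣ (fromℕ n) (x u) ⟨
    ∣ fromℕ n * x u ∣        ≡⟨ cong ∣_∣ (∑-centred x ∑x≡0 (x u)) ⟨
    ∣ ∑[ v < n ] (x u - x v) ∣ ∎

edge : ∀ {n} → Adj n → Fin n → Fin n → ℚ
edge A u v = 𝟙 (A u v ∧ (toℕ u ℕ.<ᵇ toℕ v))

cut : ∀ {n} → Adj n → (Fin n → Bool) → ℚ
cut A s = variation (edge A) (𝟙 ∘ s)

card : ∀ {n} → (Fin n → Bool) → ℚ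
card s = sum (𝟙 ∘ s)

sizeProduct : ∀ {n} → (Fin n → Bool) → ℚ
sizeProduct s = card s * card (not ∘ s)

edgeSum≡∑∑ : ∀ {n} (A : Adj n) f → edgeSum A f ≡ ∑[ u < n ] ∑[ v < n ] (edge A u v * f u v)
edgeSum≡∑∑ {n} A f = trans (sumℚ≡sum (λ u → sumℚ (term u)))
  (sum-cong-≗ {n} (λ u → trans (sumℚ≡sum (term u)) (sum-cong-≗ {n} (λ v → if-then-0 (A u v ∧ (toℕ u ℕ.<ᵇ toℕ v)) (f u v)))))
  where
  term : Fin n → Fin n → ℚ
  term u v = if A u v ∧ (toℕ u ℕ.<ᵇ toℕ v) then f u v else 0ℚ
  if-then-0 : ∀ b t → (if b then t else 0ℚ) ≡ 𝟙 b * t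
  if-then-0 true  t = sym (ℚP.*-identityˡ t)
  if-then-0 false t = sym (ℚP.*-zeroˡ t)

objective≡variation : ∀ {n} (A : Adj n) x → objective A x ≡ variation (edge A) x
objective≡variation A x = edgeSum≡∑∑ A (λ u v → ∣ x u - x v ∣)

cutSize≡cut : ∀ {n} (A : Adj n) S → cutSize A S ≡ cut A (lookup S)
cutSize≡cut A S = trans (edgeSum≡∑∑ A _)
  (∑∑-cong (λ u v → cong (edge A u v *_) (sym (∣𝟙-𝟙∣≡𝟙-xor (lookup S u) (lookup S v)))))

card-cong : ∀ {n} {s t : Fin n → Bool} → (∀ v → s v ≡ t v) → card s ≡ card t
card-cong {n} s≗t = sum-cong-≗ {n} (cong 𝟙 ∘ s≗t)

∣∣≡card : ∀ {n} (S : Subset n) → fromℕ Subset.∣ S ∣ ≡ card (lookup S)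
∣∣≡card []          = refl
∣∣≡card (true ∷ S)  = cong (_+_ 1ℚ) (∣∣≡card S)
∣∣≡card (false ∷ S) = trans (∣∣≡card S) (sym (ℚP.+-identityˡ _))

n∸∣∣≡card-not : ∀ {n} (S : Subset n) → fromℕ (n ℕ.∸ Subset.∣ S ∣) ≡ card (not ∘ lookup S)
n∸∣∣≡card-not {n} S = begin
  fromℕ (n ℕ.∸ Subset.∣ S ∣)   ≡⟨ cong fromℕ (SubsetP.∣∁p∣≡n∸∣p∣ S) ⟨
  fromℕ Subset.∣ ∁ S ∣         ≡⟨ ∣∣≡card (∁ S) ⟩
  card (lookup (∁ S))          ≡⟨ card-cong (λ v → VecP.lookup-map v not S) ⟩
  card (not ∘ lookup S)        ∎
  where open ≡-Reasoning

card+card-not : ∀ {n} (s : Fin n → Bool) → card s + card (not ∘ s) ≡ fromℕ n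
card+card-not {n} s = begin
  card s + card (not ∘ s)               ≡⟨ ∑-distrib-+ (𝟙 ∘ s) (𝟙 ∘ not ∘ s) ⟨
  ∑[ v < n ] (𝟙 (s v) + 𝟙 (not (s v)))  ≡⟨ sum-cong-≗ {n} (λ v → 𝟙+𝟙-not (s v)) ⟩
  ∑[ v < n ] 1ℚ                         ≡⟨ ∑-const n 1ℚ ⟩
  fromℕ n * 1ℚ                          ≡⟨ ℚP.*-identityʳ (fromℕ n) ⟩
  fromℕ n                               ∎
  where
  open ≡-Reasoning
  𝟙+𝟙-not : ∀ b → 𝟙 b + 𝟙 (not b) ≡ 1ℚ
  𝟙+𝟙-not true  = refl
  𝟙+𝟙-not false = refl

card-not≡ : ∀ {n} (s : Fin n → Bool) → card (not ∘ s) ≡ fromℕ n - card s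
card-not≡ {n} s = trans (solve 2 (λ a b → b := (a :+ b) :- a) refl (card s) (card (not ∘ s)))
                        (cong (_- card s) (card+card-not s))
  where open +-*-Solver

∑-if : ∀ {n} (s : Fin n → Bool) α β → ∑[ v < n ] (if s v then α else β) ≡ card s * α + card (not ∘ s) * β
∑-if {n} s α β = begin
  ∑[ v < n ] (if s v then α else β)                   ≡⟨ sum-cong-≗ {n} (λ v → by-indicators (s v)) ⟩
  ∑[ v < n ] (𝟙 (s v) * α + 𝟙 (not (s v)) * β)        ≡⟨ ∑-distrib-+ (λ v → 𝟙 (s v) * α) (λ v → 𝟙 (not (s v)) * β) ⟩
  ∑[ v < n ] (𝟙 (s v) * α) + ∑[ v < n ] (𝟙 (not (s v)) * β)
                                                      ≡⟨ cong₂ _+_ (*-distribʳ-sum α (𝟙 ∘ s)) (*-distribʳ-sum β (𝟙 ∘ not ∘ s)) ⟨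
  card s * α + card (not ∘ s) * β                     ∎
  where
  open ≡-Reasoning
  open +-*-Solver
  by-indicators : ∀ b → (if b then α else β) ≡ 𝟙 b * α + 𝟙 (not b) * β
  by-indicators true  = solve 2 (λ a b → a := con 1ℚ :* a :+ con 0ℚ :* b) refl α β
  by-indicators false = solve 2 (λ a b → b := con 0ℚ :* a :+ con 1ℚ :* b) refl α β

variation-complete : ∀ {n} (s : Fin n → Bool) → variation (λ _ _ → 1ℚ) (𝟙 ∘ s) ≡ sizeProduct s + sizeProduct s
variation-complete {n} s = begin
  variation (λ _ _ → 1ℚ) (𝟙 ∘ s)                      ≡⟨ ∑∑-cong (λ u v → trans (ℚP.*-identityˡ _) (∣𝟙-𝟙∣≡𝟙-xor (s u) (s v))) ⟩
  ∑[ u < n ] ∑[ v < n ] 𝟙 (s u xor s v)               ≡⟨ sum-cong-≗ {n} (λ u → row (s u)) ⟩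
  ∑[ u < n ] (if s u then card (not ∘ s) else card s) ≡⟨ ∑-if s (card (not ∘ s)) (card s) ⟩
  card s * card (not ∘ s) + card (not ∘ s) * card s   ≡⟨ cong (_+_ (sizeProduct s)) (ℚP.*-comm (card (not ∘ s)) (card s)) ⟩
  sizeProduct s + sizeProduct s                       ∎
  where
  open ≡-Reasoning
  row : ∀ b → ∑[ v < n ] 𝟙 (b xor s v) ≡ (if b then card (not ∘ s) else card s)
  row true  = refl
  row false = refl

card-nonneg : ∀ {n} (s : Fin n → Bool) → 0ℚ ≤ℚ card s
card-nonneg s = sum-nonneg (𝟙-nonneg ∘ s)

card-pos : ∀ {n} {s : Fin n → Bool} {v} → s v ≡ true → 1ℚ ≤ℚ card s
card-pos {s = s} {v} sv≡true = subst (_≤ℚ card s) (cong 𝟙 sv≡true) (term≤sum (𝟙-nonneg ∘ s) v)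

divℕ*card : ∀ {n} c k {s : Fin n → Bool} {v} → fromℕ k ≡ card s → s v ≡ true → divℕ c k * card s ≡ c
divℕ*card c k {s} k≡card sv≡true = trans (cong (divℕ c k *_) (sym k≡card))
  (divℕ-cancel c k (subst (0ℚ <_) (sym k≡card) (1≤⇒0< (card-pos {s = s} sv≡true))))

card-empty : ∀ {n} {s : Fin n → Bool} → (∀ v → s v ≡ false) → card s ≡ 0ℚ
card-empty {n} s≡false = trans (card-cong s≡false) (sum-replicate-zero n)

sizeProduct-nonneg : ∀ {n} (s : Fin n → Bool) → 0ℚ ≤ℚ sizeProduct s
sizeProduct-nonneg s = *-nonneg (card-nonneg s) (card-nonneg (not ∘ s))

sizeProduct-cong : ∀ {n} {s t : Fin n → Bool} → (∀ v → s v ≡ t v) → sizeProduct s ≡ sizeProduct t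
sizeProduct-cong s≗t = cong₂ _*_ (card-cong s≗t) (card-cong (cong not ∘ s≗t))

sizeProduct-pos : ∀ {n} {s : Fin n → Bool} {u v} → s u ≡ true → s v ≡ false → 0ℚ < sizeProduct s
sizeProduct-pos {s = s} su≡true sv≡false =
  *-pos (1≤⇒0< (card-pos {s = s} su≡true)) (1≤⇒0< (card-pos {s = not ∘ s} (cong not sv≡false)))

cut-not : ∀ {n} (A : Adj n) s → cut A (not ∘ s) ≡ cut A s
cut-not A s = ∑∑-cong (λ u v → cong (edge A u v *_) (∣𝟙not-𝟙not∣ (s u) (s v)))
  where
  ∣𝟙not-𝟙not∣ : ∀ a b → ∣ 𝟙 (not a) - 𝟙 (not b) ∣ ≡ ∣ 𝟙 a - 𝟙 b ∣
  ∣𝟙not-𝟙not∣ true  true  = refl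
  ∣𝟙not-𝟙not∣ true  false = refl
  ∣𝟙not-𝟙not∣ false true  = refl
  ∣𝟙not-𝟙not∣ false false = refl

sizeProduct-not : ∀ {n} (s : Fin n → Bool) → sizeProduct (not ∘ s) ≡ sizeProduct s
sizeProduct-not s = trans (cong (card (not ∘ s) *_) (card-cong (BoolP.not-involutive ∘ s))) (ℚP.*-comm (card (not ∘ s)) (card s))

cut-term-nonneg : ∀ {n} (A : Adj n) (s : Fin n → Bool) u v → 0ℚ ≤ℚ edge A u v * ∣ 𝟙 (s u) - 𝟙 (s v) ∣
cut-term-nonneg A s u v = *-nonneg (𝟙-nonneg (A u v ∧ (toℕ u ℕ.<ᵇ toℕ v))) (ℚP.0≤∣p∣ (𝟙 (s u) - 𝟙 (s v)))

cut-nonneg : ∀ {n} (A : Adj n) (s : Fin n → Bool) → 0ℚ ≤ℚ cut A s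
cut-nonneg A s = sum-nonneg (λ u → sum-nonneg (cut-term-nonneg A s u))

module _ {n} {A : Adj n} (s : Fin n → Bool) where

  crossing-edge : ∀ {Y a b} → ReachIn A Y a b → s a ≡ true → s b ≡ false →
                  ∃ λ p → ∃ λ q → A p q ≡ true × s p ≡ true × s q ≡ false
  crossing-edge (here _) sa≡true sb≡false = ⊥-elim (BoolP.not-¬ sa≡true sb≡false)
  crossing-edge {a = a} (step {w = w} _ Aaw walk) sa≡true sb≡false with s w in sw
  ... | true  = crossing-edge walk sw sb≡false
  ... | false = a , w , Aaw , sa≡true , sw

  private
    crossing-term : ∀ {p q} → A p q ≡ true → p Fin.< q → s p xor s q ≡ true → edge A p q * ∣ 𝟙 (s p) - 𝟙 (s q) ∣ ≡ 1ℚ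
    crossing-term {p} {q} Apq p<q crosses = cong₂ _*_
      (cong 𝟙 (cong₂ _∧_ Apq (Equivalence.to BoolP.T-≡ (ℕP.<⇒<ᵇ p<q))))
      (trans (∣𝟙-𝟙∣≡𝟙-xor (s p) (s q)) (cong 𝟙 crosses))

  cut-pos : IsSimple A → Connected A → ∀ {a b} → s a ≡ true → s b ≡ false → 1ℚ ≤ℚ cut A s
  cut-pos simple connected {a} {b} sa≡true sb≡false with crossing-edge (connected a b) sa≡true sb≡false
  ... | p , q , Apq , sp , sq with FinP.<-cmp p q
  ...   | tri< p<q _ _ = subst (_≤ℚ cut A s) (crossing-term Apq p<q (cong₂ _xor_ sp sq)) (term≤∑∑ (cut-term-nonneg A s) p q)
  ...   | tri≈ _ p≡q _ = ⊥-elim (BoolP.not-¬ sp (trans (cong s p≡q) sq))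
  ...   | tri> _ _ q<p = subst (_≤ℚ cut A s) (crossing-term Aqp q<p (cong₂ _xor_ sq sp)) (term≤∑∑ (cut-term-nonneg A s) q p)
    where
    Aqp : A q p ≡ true
    Aqp = trans (proj₁ simple q p) Apq

Proper : ∀ {n} → Subset n → Set
Proper S = Nonempty S × Nonempty (∁ S)

∈⇒lookup≡true : ∀ {n} {S : Subset n} {v} → v ∈ S → lookup S v ≡ true
∈⇒lookup≡true = VecP.[]=⇒lookup

∈∁⇒lookup≡false : ∀ {n} {S : Subset n} {v} → v ∈ ∁ S → lookup S v ≡ false
∈∁⇒lookup≡false {S = S} {v} v∈∁S =
  trans (sym (BoolP.not-involutive _)) (cong not (trans (sym (VecP.lookup-map v not S)) (∈⇒lookup≡true v∈∁S)))

ρ*sizeProduct : ∀ {n} (A : Adj n) S → Proper S → ρ A S * sizeProduct (lookup S) ≡ cut A (lookup S)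
ρ*sizeProduct {n} A S ((u , u∈S) , (v , v∈∁S)) = begin
  ρ A S * sizeProduct (lookup S)       ≡⟨ cong (ρ A S *_) fromℕ-k ⟨
  divℕ (cutSize A S) k * fromℕ k      ≡⟨ divℕ-cancel (cutSize A S) k (subst (0ℚ <_) (sym fromℕ-k) sizes-pos) ⟩
  cutSize A S                         ≡⟨ cutSize≡cut A S ⟩
  cut A (lookup S)                    ∎
  where
  open ≡-Reasoning
  k : ℕ
  k = Subset.∣ S ∣ ℕ.* (n ℕ.∸ Subset.∣ S ∣)
  fromℕ-k : fromℕ k ≡ sizeProduct (lookup S)
  fromℕ-k = trans (×1-homo-* Subset.∣ S ∣ (n ℕ.∸ Subset.∣ S ∣)) (cong₂ _*_ (∣∣≡card S) (n∸∣∣≡card-not S))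
  sizes-pos : 0ℚ < sizeProduct (lookup S)
  sizes-pos = sizeProduct-pos {s = lookup S} (∈⇒lookup≡true u∈S) (∈∁⇒lookup≡false v∈∁S)

ρ-pos : ∀ {n} {A : Adj n} → IsSimple A → Connected A → ∀ S → Proper S → 0ℚ < ρ A S
ρ-pos {A = A} simple connected S S-proper@((u , u∈S) , (v , v∈∁S)) =
  ℚP.*-cancelʳ-<-nonNeg (sizeProduct (lookup S)) {{ℚ.nonNegative (sizeProduct-nonneg (lookup S))}} (begin-strict
    0ℚ * sizeProduct (lookup S)         ≡⟨ ℚP.*-zeroˡ (sizeProduct (lookup S)) ⟩
    0ℚ                                  <⟨ 1≤⇒0< (cut-pos (lookup S) simple connected (∈⇒lookup≡true u∈S) (∈∁⇒lookup≡false v∈∁S)) ⟩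
    cut A (lookup S)                    ≡⟨ ρ*sizeProduct A S S-proper ⟨
    ρ A S * sizeProduct (lookup S)      ∎)
  where open ℚP.≤-Reasoning

CutBound : ∀ {n} → Adj n → ℚ → Set
CutBound {n} A r = ∀ (s : Fin n → Bool) → r * sizeProduct s ≤ℚ cut A s

tabulate-proper : ∀ {n} {s : Fin n → Bool} {u v} → s u ≡ true → s v ≡ false → Proper (Vec.tabulate s)
tabulate-proper {s = s} {u} {v} su≡true sv≡false =
    (u , VecP.lookup⇒[]= u S (trans (VecP.lookup∘tabulate s u) su≡true))
  , (v , VecP.lookup⇒[]= v (∁ S) (trans (VecP.lookup-map v not S) (cong not (trans (VecP.lookup∘tabulate s v) sv≡false))))
  where
  S = Vec.tabulate s

ρ-lower-bound⇒CutBound : ∀ {n} (A : Adj n) {r} → (∀ S → Proper S → r ≤ℚ ρ A S) → CutBound A r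
ρ-lower-bound⇒CutBound A {r} r≤ρ s = by-sides (FinP.any? (λ v → s v Bool.≟ true)) (FinP.any? (λ v → s v Bool.≟ false))
  where
  open ℚP.≤-Reasoning
  S = Vec.tabulate s
  s≗S : ∀ v → s v ≡ lookup S v
  s≗S v = sym (VecP.lookup∘tabulate s v)
  one-sided : sizeProduct s ≡ 0ℚ → r * sizeProduct s ≤ℚ cut A s
  one-sided P≡0 = begin
    r * sizeProduct s   ≡⟨ cong (r *_) P≡0 ⟩
    r * 0ℚ              ≡⟨ ℚP.*-zeroʳ r ⟩
    0ℚ                  ≤⟨ cut-nonneg A s ⟩
    cut A s             ∎
  by-sides : Dec (∃ λ v → s v ≡ true) → Dec (∃ λ v → s v ≡ false) → r * sizeProduct s ≤ℚ cut A s
  by-sides (yes (u , su≡true)) (yes (v , sv≡false)) = begin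
    r * sizeProduct s                ≡⟨ cong (r *_) (sizeProduct-cong s≗S) ⟩
    r * sizeProduct (lookup S)       ≤⟨ *-monoʳ-≤-nonneg (sizeProduct-nonneg (lookup S)) (r≤ρ S S-proper) ⟩
    ρ A S * sizeProduct (lookup S)   ≡⟨ ρ*sizeProduct A S S-proper ⟩
    cut A (lookup S)                 ≡⟨ variation-cong (edge A) (cong 𝟙 ∘ s≗S) ⟨
    cut A s                          ∎
    where
    S-proper : Proper S
    S-proper = tabulate-proper su≡true sv≡false
  by-sides (no ∄true) _ = one-sided (trans (cong (_* card (not ∘ s)) (card-empty (λ v → BoolP.¬-not (∄true ∘ (v ,_)))))
                                           (ℚP.*-zeroˡ (card (not ∘ s))))
  by-sides _ (no ∄false) = one-sided (trans (cong (card s *_) (card-empty (λ v → cong not (BoolP.¬-not (∄false ∘ (v ,_))))))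
                                            (ℚP.*-zeroʳ (card s)))

-- Lower bound on b(G)

module _ {n} {A : Adj n} {r} (r≥0 : 0ℚ ≤ℚ r) (bound : CutBound A r) where

  private
    complete : Fin n → Fin n → ℚ
    complete _ _ = 1ℚ

    -- complete counts every pair {u, v} twice, edge counts every edge once.
    w : Fin n → Fin n → ℚ
    w u v = edge A u v - (½ * r) * complete u v

    cuts-nonneg : ∀ s → 0ℚ ≤ℚ variation w (𝟙 ∘ s)
    cuts-nonneg s = begin
      0ℚ                                                      ≤⟨ p≤q⇒0≤q-p (bound s) ⟩
      cut A s - r * sizeProduct s                             ≡⟨ halve (cut A s) r (sizeProduct s) ⟩
      cut A s - (½ * r) * (sizeProduct s + sizeProduct s)     ≡⟨ cong (λ V → cut A s - (½ * r) * V) (variation-complete s) ⟨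
      cut A s - (½ * r) * variation complete (𝟙 ∘ s)          ≡⟨ variation-sub (edge A) complete (½ * r) (𝟙 ∘ s) ⟨
      variation w (𝟙 ∘ s)                                     ∎
      where
      open ℚP.≤-Reasoning
      open +-*-Solver
      halve : ∀ c r P → c - r * P ≡ c - (½ * r) * (P + P)
      halve = solve 3 (λ c r P → c :- r :* P := c :- (con ½ :* r) :* (P :+ P)) refl

  objective-lower-bound : ∀ x → Feasible x → (+ n / 2) * r ≤ℚ objective A x
  objective-lower-bound x (∑x≡0 , ∑∣x∣≡1) = begin
    (+ n / 2) * r                                  ≡⟨ cong (_* r) (/2≡fromℕ*½ n) ⟩
    fromℕ n * ½ * r                                ≡⟨ regroup (fromℕ n) r ⟩
    (½ * r) * (fromℕ n * 1ℚ)                       ≡⟨ cong (λ t → (½ * r) * (fromℕ n * t)) (trans (sym (sumℚ≡sum (∣_∣ ∘ x))) ∑∣x∣≡1) ⟨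
    (½ * r) * (fromℕ n * sum (∣_∣ ∘ x))            ≤⟨ *-monoˡ-≤-nonneg ½r≥0 (mean-deviation x (trans (sym (sumℚ≡sum x)) ∑x≡0)) ⟩
    (½ * r) * variation complete x                 ≤⟨ 0≤q-p⇒p≤q w-variation-nonneg ⟩
    variation (edge A) x                           ≡⟨ objective≡variation A x ⟨
    objective A x                                  ∎
    where
    open ℚP.≤-Reasoning
    open +-*-Solver
    regroup : ∀ m r → m * ½ * r ≡ (½ * r) * (m * 1ℚ)
    regroup = solve 2 (λ m r → m :* con ½ :* r := (con ½ :* r) :* (m :* con 1ℚ)) refl
    ½r≥0 : 0ℚ ≤ℚ ½ * r
    ½r≥0 = *-nonneg (ℚP.<⇒≤ (ℚP.positive⁻¹ ½)) r≥0
    w-variation-nonneg : 0ℚ ≤ℚ variation (edge A) x - (½ * r) * variation complete x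
    w-variation-nonneg = subst (0ℚ ≤ℚ_) (variation-sub (edge A) complete (½ * r) x) (variation-nonneg w cuts-nonneg x)

-- Cut vectors

module _ {n} (A : Adj n) (S : Subset n) (S-proper : Proper S) where

  private
    s : Fin n → Bool
    s = lookup S

    α β : ℚ
    α = divℕ ½ Subset.∣ S ∣
    β = divℕ ½ (n ℕ.∸ Subset.∣ S ∣)

    α≥0 : 0ℚ ≤ℚ α
    α≥0 = divℕ-nonneg Subset.∣ S ∣ (ℚP.<⇒≤ (ℚP.positive⁻¹ ½))

    β≥0 : 0ℚ ≤ℚ β
    β≥0 = divℕ-nonneg (n ℕ.∸ Subset.∣ S ∣) (ℚP.<⇒≤ (ℚP.positive⁻¹ ½))

    α*card : α * card s ≡ ½
    α*card = divℕ*card ½ Subset.∣ S ∣ {s} (∣∣≡card S) (∈⇒lookup≡true (proj₂ (proj₁ S-proper)))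

    β*card-not : β * card (not ∘ s) ≡ ½
    β*card-not = divℕ*card ½ (n ℕ.∸ Subset.∣ S ∣) {not ∘ s} (n∸∣∣≡card-not S) (cong not (∈∁⇒lookup≡false (proj₂ (proj₂ S-proper))))

  cutVector : Fin n → ℚ
  cutVector v = if s v then α else - β

  cutVector-feasible : Feasible cutVector
  cutVector-feasible = ∑≡0 , ∑∣∣≡1
    where
    open ≡-Reasoning
    open +-*-Solver
    ∑≡0 : sumℚ cutVector ≡ 0ℚ
    ∑≡0 = begin
      sumℚ cutVector                          ≡⟨ sumℚ≡sum cutVector ⟩
      sum cutVector                           ≡⟨ ∑-if s α (- β) ⟩
      card s * α + card (not ∘ s) * - β       ≡⟨ solve 4 (λ a α b β → a :* α :+ b :* (:- β) := α :* a :- β :* b) refl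
                                                         (card s) α (card (not ∘ s)) β ⟩
      α * card s - β * card (not ∘ s)         ≡⟨ cong₂ _-_ α*card β*card-not ⟩
      ½ - ½                                   ≡⟨ ℚP.+-inverseʳ ½ ⟩
      0ℚ                                      ∎
    ∣cutVector∣ : ∀ v → ∣ cutVector v ∣ ≡ (if s v then α else β)
    ∣cutVector∣ v with s v
    ... | true  = ℚP.0≤p⇒∣p∣≡p α≥0
    ... | false = trans (ℚP.∣-p∣≡∣p∣ β) (ℚP.0≤p⇒∣p∣≡p β≥0)
    ∑∣∣≡1 : sumℚ (λ v → ∣ cutVector v ∣) ≡ 1ℚ
    ∑∣∣≡1 = begin
      sumℚ (λ v → ∣ cutVector v ∣)            ≡⟨ sumℚ≡sum (λ v → ∣ cutVector v ∣) ⟩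
      sum (λ v → ∣ cutVector v ∣)             ≡⟨ sum-cong-≗ {n} ∣cutVector∣ ⟩
      ∑[ v < n ] (if s v then α else β)       ≡⟨ ∑-if s α β ⟩
      card s * α + card (not ∘ s) * β         ≡⟨ cong₂ _+_ (ℚP.*-comm (card s) α) (ℚP.*-comm (card (not ∘ s)) β) ⟩
      α * card s + β * card (not ∘ s)         ≡⟨ cong₂ _+_ α*card β*card-not ⟩
      ½ + ½                                   ≡⟨⟩
      1ℚ                                      ∎

  objective-cutVector : objective A cutVector ≡ (+ n / 2) * ρ A S
  objective-cutVector = begin
    objective A cutVector                                  ≡⟨ objective≡variation A cutVector ⟩
    variation (edge A) cutVector                           ≡⟨ variation-cong (edge A) (affine ∘ s) ⟩
    variation (edge A) (λ v → - β + (α + β) * 𝟙 (s v))     ≡⟨ variation-affine (edge A) (- β) (α + β) (𝟙 ∘ s) ⟩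
    ∣ α + β ∣ * cut A s                                    ≡⟨ cong (_* cut A s) (ℚP.0≤p⇒∣p∣≡p (ℚP.+-mono-≤ α≥0 β≥0)) ⟩
    (α + β) * cut A s                                      ≡⟨ cong ((α + β) *_) (ρ*sizeProduct A S S-proper) ⟨
    (α + β) * (ρ A S * (card s * card (not ∘ s)))          ≡⟨ spread α β (ρ A S) (card s) (card (not ∘ s)) ⟩
    ρ A S * ((α * card s) * card (not ∘ s) + (β * card (not ∘ s)) * card s)
                                                           ≡⟨ cong₂ (λ p q → ρ A S * (p * card (not ∘ s) + q * card s)) α*card β*card-not ⟩
    ρ A S * (½ * card (not ∘ s) + ½ * card s)              ≡⟨ collect (ρ A S) (card s) (card (not ∘ s)) ⟩
    (card s + card (not ∘ s)) * ½ * ρ A S                  ≡⟨ cong (λ m → m * ½ * ρ A S) (card+card-not s) ⟩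
    fromℕ n * ½ * ρ A S                                    ≡⟨ cong (_* ρ A S) (/2≡fromℕ*½ n) ⟨
    (+ n / 2) * ρ A S                                      ∎
    where
    open ≡-Reasoning
    open +-*-Solver
    affine : ∀ b → (if b then α else - β) ≡ - β + (α + β) * 𝟙 b
    affine true  = solve 2 (λ α β → α := :- β :+ (α :+ β) :* con 1ℚ) refl α β
    affine false = solve 2 (λ α β → :- β := :- β :+ (α :+ β) :* con 0ℚ) refl α β
    spread : ∀ α β ρ a b → (α + β) * (ρ * (a * b)) ≡ ρ * ((α * a) * b + (β * b) * a)
    spread = solve 5 (λ α β ρ a b → (α :+ β) :* (ρ :* (a :* b)) := ρ :* ((α :* a) :* b :+ (β :* b) :* a)) refl
    collect : ∀ ρ a b → ρ * (½ * b + ½ * a) ≡ (a + b) * ½ * ρ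
    collect = solve 3 (λ ρ a b → ρ :* (con ½ :* b :+ con ½ :* a) := (a :+ b) :* con ½ :* ρ) refl

-- Connectivity of minimisers

module _ {n} (A : Adj n) (X : Subset n) where

  reach-extend : ∀ {u p q} → ReachIn A X u p → A p q ≡ true → q ∈ X → ReachIn A X u q
  reach-extend (here p∈X)         Apq q∈X = step p∈X Apq (here q∈X)
  reach-extend (step u∈X Auw walk) Apq q∈X = step u∈X Auw (reach-extend walk Apq q∈X)

  reach-end∈ : ∀ {u w} → ReachIn A X u w → w ∈ X
  reach-end∈ (here w∈X)      = w∈X
  reach-end∈ (step _ _ walk) = reach-end∈ walk

  ReachedFrom : Fin n → Subset n → Set
  ReachedFrom u R = ∀ {w} → w ∈ R → ReachIn A X u w

  ClosedIn : Subset n → Set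
  ClosedIn R = ∀ {p q} → p ∈ R → q ∈ X → A p q ≡ true → q ∈ R

  private
    Frontier : Subset n → Set
    Frontier R = ∃ λ q → q ∈ X × ¬ q ∈ R × ∃ λ p → p ∈ R × A p q ≡ true

    frontier? : ∀ R → Dec (Frontier R)
    frontier? R = FinP.any? (λ q → (q SubsetP.∈? X) ×-dec ¬? (q SubsetP.∈? R)
                                   ×-dec FinP.any? (λ p → (p SubsetP.∈? R) ×-dec (A p q Bool.≟ true)))

    grow : ∀ {u} R → Acc _⊃_ R → u ∈ R → ReachedFrom u R → Σ (Subset n) λ C → u ∈ C × ReachedFrom u C × ClosedIn C
    grow {u} R (acc larger) u∈R reached with frontier? R
    ... | yes (q , q∈X , q∉R , p , p∈R , Apq) =
      grow (R ∪ ⁅ q ⁆) (larger R⊂R∪q) (SubsetP.p⊆p∪q ⁅ q ⁆ u∈R) reached′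
      where
      R⊂R∪q : R Subset.⊂ (R ∪ ⁅ q ⁆)
      R⊂R∪q = SubsetP.p⊆p∪q ⁅ q ⁆ , q , SubsetP.x∈p∪q⁺ (inj₂ (SubsetP.x∈⁅x⁆ q)) , q∉R
      reached′ : ReachedFrom u (R ∪ ⁅ q ⁆)
      reached′ {w} w∈R∪q with SubsetP.x∈p∪q⁻ R ⁅ q ⁆ w∈R∪q
      ... | inj₁ w∈R = reached w∈R
      ... | inj₂ w∈q = subst (ReachIn A X u) (sym (SubsetP.x∈⁅y⁆⇒x≡y q w∈q)) (reach-extend (reached p∈R) Apq q∈X)
    ... | no no-frontier = R , u∈R , reached , closed
      where
      closed : ClosedIn R
      closed {p} {q} p∈R q∈X Apq with q SubsetP.∈? R
      ... | yes q∈R = q∈R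
      ... | no  q∉R = ⊥-elim (no-frontier (q , q∈X , q∉R , p , p∈R , Apq))

  component : ∀ {u} → u ∈ X → Σ (Subset n) λ C → u ∈ C × ReachedFrom u C × ClosedIn C
  component {u} u∈X = grow ⁅ u ⁆ (⊃-wellFounded ⁅ u ⁆) (SubsetP.x∈⁅x⁆ u)
    (λ w∈u → subst (ReachIn A X u) (sym (SubsetP.x∈⁅y⁆⇒x≡y u w∈u)) (here u∈X))

𝟙-xor-∨ : ∀ a b a′ b′ → a ∧ b ≡ false → a′ ∧ b′ ≡ false → a ∧ b′ ≡ false → a′ ∧ b ≡ false →
          𝟙 ((a ∨ b) xor (a′ ∨ b′)) ≡ 𝟙 (a xor a′) + 𝟙 (b xor b′)
𝟙-xor-∨ true  true  _     _     () _  _  _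
𝟙-xor-∨ _     _     true  true  _  () _  _
𝟙-xor-∨ true  _     _     true  _  _  () _
𝟙-xor-∨ _     true  true  _     _  _  _  ()
𝟙-xor-∨ true  false true  false _  _  _  _ = refl
𝟙-xor-∨ true  false false false _  _  _  _ = refl
𝟙-xor-∨ false true  false true  _  _  _  _ = refl
𝟙-xor-∨ false true  false false _  _  _  _ = refl
𝟙-xor-∨ false false true  false _  _  _  _ = refl
𝟙-xor-∨ false false false true  _  _  _  _ = refl
𝟙-xor-∨ false false false false _  _  _  _ = refl

card-disjoint-∨ : ∀ {n} (s t : Fin n → Bool) → (∀ v → s v ∧ t v ≡ false) → card (λ v → s v ∨ t v) ≡ card s + card t
card-disjoint-∨ {n} s t disjoint = trans (sum-cong-≗ {n} (λ v → 𝟙-∨ (s v) (t v) (disjoint v))) (∑-distrib-+ (𝟙 ∘ s) (𝟙 ∘ t))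
  where
  𝟙-∨ : ∀ a b → a ∧ b ≡ false → 𝟙 (a ∨ b) ≡ 𝟙 a + 𝟙 b
  𝟙-∨ true  true  ()
  𝟙-∨ true  false _ = refl
  𝟙-∨ false true  _ = refl
  𝟙-∨ false false _ = refl

module _ {n} {A : Adj n} (simple : IsSimple A) (s t : Fin n → Bool)
         (disjoint : ∀ v → s v ∧ t v ≡ false) (separated : ∀ p q → A p q ≡ true → s p ∧ t q ≡ false) where

  cut-separated-∨ : cut A (λ v → s v ∨ t v) ≡ cut A s + cut A t
  cut-separated-∨ = trans (∑∑-cong term) (∑∑-distrib-+ (λ p q → edge A p q * ∣ 𝟙 (s p) - 𝟙 (s q) ∣)
                                                       (λ p q → edge A p q * ∣ 𝟙 (t p) - 𝟙 (t q) ∣))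
    where
    scaled-split : ∀ e {X Y Z} → e ≡ 0ℚ ⊎ X ≡ Y + Z → e * X ≡ e * Y + e * Z
    scaled-split _ {X} {Y} {Z} (inj₁ refl) = trans (ℚP.*-zeroˡ X) (sym (cong₂ _+_ (ℚP.*-zeroˡ Y) (ℚP.*-zeroˡ Z)))
    scaled-split e {X} {Y} {Z} (inj₂ refl) = ℚP.*-distribˡ-+ e Y Z
    term : ∀ p q → edge A p q * ∣ 𝟙 (s p ∨ t p) - 𝟙 (s q ∨ t q) ∣
                 ≡ edge A p q * ∣ 𝟙 (s p) - 𝟙 (s q) ∣ + edge A p q * ∣ 𝟙 (t p) - 𝟙 (t q) ∣
    term p q = scaled-split (edge A p q) (by-adjacency (A p q) refl)
      where
      by-adjacency : ∀ b → A p q ≡ b → edge A p q ≡ 0ℚ ⊎ ∣ 𝟙 (s p ∨ t p) - 𝟙 (s q ∨ t q) ∣ ≡ ∣ 𝟙 (s p) - 𝟙 (s q) ∣ + ∣ 𝟙 (t p) - 𝟙 (t q) ∣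
      by-adjacency false Apq = inj₁ (cong (λ b → 𝟙 (b ∧ (toℕ p ℕ.<ᵇ toℕ q))) Apq)
      by-adjacency true  Apq = inj₂ (begin
        ∣ 𝟙 (s p ∨ t p) - 𝟙 (s q ∨ t q) ∣              ≡⟨ ∣𝟙-𝟙∣≡𝟙-xor (s p ∨ t p) (s q ∨ t q) ⟩
        𝟙 ((s p ∨ t p) xor (s q ∨ t q))                 ≡⟨ 𝟙-xor-∨ (s p) (t p) (s q) (t q) (disjoint p) (disjoint q)
                                                            (separated p q Apq) (separated q p (trans (proj₁ simple q p) Apq)) ⟩
        𝟙 (s p xor s q) + 𝟙 (t p xor t q)               ≡⟨ cong₂ _+_ (∣𝟙-𝟙∣≡𝟙-xor (s p) (s q)) (∣𝟙-𝟙∣≡𝟙-xor (t p) (t q)) ⟨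
        ∣ 𝟙 (s p) - 𝟙 (s q) ∣ + ∣ 𝟙 (t p) - 𝟙 (t q) ∣   ∎)
        where open ≡-Reasoning

module _ {n} {A : Adj n} (simple : IsSimple A) {r} (r>0 : 0ℚ < r) (bound : CutBound A r) where

  cut-separated-∨-exceeds : ∀ (s t : Fin n → Bool) → (∀ v → s v ∧ t v ≡ false) → (∀ p q → A p q ≡ true → s p ∧ t q ≡ false) →
                            ∀ {u v} → s u ≡ true → t v ≡ true → r * sizeProduct (λ w → s w ∨ t w) < cut A (λ w → s w ∨ t w)
  cut-separated-∨-exceeds s t disjoint separated su tv = begin-strict
    r * sizeProduct (λ w → s w ∨ t w)                     ≡⟨ cong (r *_) (trans (cong (card x *_) (card-not≡ x)) (cong (λ c → c * (N - c)) card-x)) ⟩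
    r * ((a + b) * (N - (a + b)))                         ≡⟨ ℚP.+-identityʳ _ ⟨
    r * ((a + b) * (N - (a + b))) + 0ℚ                    <⟨ ℚP.+-monoʳ-< (r * ((a + b) * (N - (a + b)))) gap-pos ⟩
    r * ((a + b) * (N - (a + b))) + (r * a * b + r * a * b) ≡⟨ expand r a b N ⟩
    r * (a * (N - a)) + r * (b * (N - b))                 ≡⟨ cong₂ (λ p q → r * (a * p) + r * (b * q)) (card-not≡ s) (card-not≡ t) ⟨
    r * sizeProduct s + r * sizeProduct t                 ≤⟨ ℚP.+-mono-≤ (bound s) (bound t) ⟩
    cut A s + cut A t                                     ≡⟨ cut-separated-∨ simple s t disjoint separated ⟨
    cut A x                                               ∎
    where
    open ℚP.≤-Reasoning
    open +-*-Solver
    x : Fin n → Bool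
    x w = s w ∨ t w
    a b N : ℚ
    a = card s
    b = card t
    N = fromℕ n
    card-x : card x ≡ a + b
    card-x = card-disjoint-∨ s t disjoint
    gap-pos : 0ℚ < r * a * b + r * a * b
    gap-pos = ℚP.+-mono-< rab>0 rab>0
      where
      rab>0 : 0ℚ < r * a * b
      rab>0 = *-pos (*-pos r>0 (1≤⇒0< (card-pos {s = s} su))) (1≤⇒0< (card-pos {s = t} tv))
    expand : ∀ r a b N → r * ((a + b) * (N - (a + b))) + (r * a * b + r * a * b) ≡ r * (a * (N - a)) + r * (b * (N - b))
    expand = solve 4 (λ r a b N → r :* ((a :+ b) :* (N :- (a :+ b))) :+ (r :* a :* b :+ r :* a :* b)
                                  := r :* (a :* (N :- a)) :+ r :* (b :* (N :- b))) refl

  attaining⇒connected : ∀ X → cut A (lookup X) ≤ℚ r * sizeProduct (lookup X) → InducedConnected A X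
  attaining⇒connected X attains u v u∈X v∈X with component A X u∈X
  ... | R , u∈R , reached , closed with v SubsetP.∈? R
  ...   | yes v∈R = reached v∈R
  ...   | no  v∉R = ⊥-elim (ℚP.<-irrefl refl (ℚP.<-≤-trans exceeds attains′))
    where
    s t : Fin n → Bool
    s = lookup R
    t w = lookup X w ∧ not (lookup R w)
    R⊆X : ∀ w → s w ≡ true → lookup X w ≡ true
    R⊆X w sw = ∈⇒lookup≡true (reach-end∈ A X (reached (VecP.lookup⇒[]= w R sw)))
    X≗s∨t : ∀ w → lookup X w ≡ s w ∨ t w
    X≗s∨t w with s w in sw
    ... | true  = R⊆X w sw
    ... | false = sym (BoolP.∧-identityʳ (lookup X w))
    disjoint : ∀ w → s w ∧ t w ≡ false
    disjoint w with s w
    ... | true  = BoolP.∧-zeroʳ (lookup X w)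
    ... | false = refl
    separated : ∀ p q → A p q ≡ true → s p ∧ t q ≡ false
    separated p q Apq with s p in sp | lookup X q in xq
    ... | false | _     = refl
    ... | true  | false = refl
    ... | true  | true  = cong not (∈⇒lookup≡true (closed (VecP.lookup⇒[]= p R sp) (VecP.lookup⇒[]= q X xq) Apq))
    exceeds : r * sizeProduct (λ w → s w ∨ t w) < cut A (λ w → s w ∨ t w)
    exceeds = cut-separated-∨-exceeds s t disjoint separated {u} {v}
                (∈⇒lookup≡true u∈R) (cong₂ _∧_ (∈⇒lookup≡true v∈X) (cong not (BoolP.¬-not (v∉R ∘ VecP.lookup⇒[]= v R))))
    attains′ : cut A (λ w → s w ∨ t w) ≤ℚ r * sizeProduct (λ w → s w ∨ t w)
    attains′ = subst₂ (λ c P → c ≤ℚ r * P) (variation-cong (edge A) (cong 𝟙 ∘ X≗s∨t)) (sizeProduct-cong X≗s∨t) attains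

attains-∁ : ∀ {n} (A : Adj n) r S → cut A (lookup S) ≤ℚ r * sizeProduct (lookup S) →
            cut A (lookup (∁ S)) ≤ℚ r * sizeProduct (lookup (∁ S))
attains-∁ A r S attains = begin
  cut A (lookup (∁ S))               ≡⟨ variation-cong (edge A) (cong 𝟙 ∘ ∁≗not) ⟨
  cut A (not ∘ lookup S)             ≡⟨ cut-not A (lookup S) ⟩
  cut A (lookup S)                   ≤⟨ attains ⟩
  r * sizeProduct (lookup S)         ≡⟨ cong (r *_) (sizeProduct-not (lookup S)) ⟨
  r * sizeProduct (not ∘ lookup S)   ≡⟨ cong (r *_) (sizeProduct-cong ∁≗not) ⟩
  r * sizeProduct (lookup (∁ S))     ∎
  where
  open ℚP.≤-Reasoning
  ∁≗not : ∀ v → not (lookup S v) ≡ lookup (∁ S) v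
  ∁≗not v = sym (VecP.lookup-map v not S)

subsets : ∀ n → List (Subset n)
subsets zero    = [ [] ]
subsets (suc n) = map (true ∷_) (subsets n) ++ map (false ∷_) (subsets n)

∈-subsets : ∀ {n} (S : Subset n) → S ∈ₗ subsets n
∈-subsets []                  = here refl
∈-subsets (true ∷ S)          = ∈-++⁺ˡ (∈-map⁺ (true ∷_) (∈-subsets S))
∈-subsets {suc n} (false ∷ S) = ∈-++⁺ʳ (map (true ∷_) (subsets n)) (∈-map⁺ (false ∷_) (∈-subsets S))

minimiser : ∀ {B : Set} (xs : List B) → (∀ b → b ∈ₗ xs) → {P : Pred B 0ℓ} → Decidable P →
            ∀ {b₀} → P b₀ → (f : B → ℚ) → Σ B λ b → P b × (∀ c → P c → f b ≤ℚ f c)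
minimiser xs complete P? {b₀} Pb₀ f =
  argmin f b₀ candidates , argmin-all f Pb₀ (all-filter P? xs) ,
  λ c Pc → All.lookup (f[argmin]≤f[xs] b₀ candidates) (∈-filter⁺ P? (complete c) Pc)
  where
  candidates = filter P? xs

proper? : ∀ {n} → Decidable (Proper {n})
proper? S = SubsetP.nonempty? S ×-dec SubsetP.nonempty? (∁ S)

proper-subset : ∀ {n} → 2 ≤ n → Σ (Subset n) Proper
proper-subset (ℕ.s≤s (ℕ.s≤s ℕ.z≤n)) = true ∷ Vec.replicate _ false , (Fin.zero , Vec.here) , (Fin.suc Fin.zero , Vec.there Vec.here)

theorem3p4 : (n : ℕ) → 2 ≤ n → (A : Adj n) → IsSimple A → Connected A →
    Σ (Subset n) (λ S₀ → Admissible A S₀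
      × (∀ S → Admissible A S → ρ A S₀ ≤ℚ ρ A S)
      × IsB A ((+ n / 2) * ρ A S₀))
theorem3p4 n 2≤n A simple connected = conclude (minimiser (subsets n) ∈-subsets proper? (proj₂ (proper-subset 2≤n)) (ρ A))
  where
  conclude : Σ (Subset n) (λ S₀ → Proper S₀ × (∀ S → Proper S → ρ A S₀ ≤ℚ ρ A S)) →
             Σ (Subset n) (λ S₀ → Admissible A S₀ × (∀ S → Admissible A S → ρ A S₀ ≤ℚ ρ A S) × IsB A ((+ n / 2) * ρ A S₀))
  conclude (S₀ , S₀-proper , ρ-minimal) =
    S₀ , (proj₁ S₀-proper , proj₂ S₀-proper , connected-on S₀ attains , connected-on (∁ S₀) (attains-∁ A (ρ A S₀) S₀ attains))
       , (λ S (S≢∅ , ∁S≢∅ , _) → ρ-minimal S (S≢∅ , ∁S≢∅))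
       , objective-lower-bound (ℚP.<⇒≤ ρ₀>0) bound
       , cutVector A S₀ S₀-proper , cutVector-feasible A S₀ S₀-proper , objective-cutVector A S₀ S₀-proper
    where
    ρ₀>0 : 0ℚ < ρ A S₀
    ρ₀>0 = ρ-pos simple connected S₀ S₀-proper
    bound : CutBound A (ρ A S₀)
    bound = ρ-lower-bound⇒CutBound A ρ-minimal
    connected-on : ∀ X → cut A (lookup X) ≤ℚ ρ A S₀ * sizeProduct (lookup X) → InducedConnected A X
    connected-on = attaining⇒connected simple ρ₀>0 bound
    attains : cut A (lookup S₀) ≤ℚ ρ A S₀ * sizeProduct (lookup S₀)
    attains = ℚP.≤-reflexive (sym (ρ*sizeProduct A S₀ S₀-proper))
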